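{- Let $\mathcal{H}$ be a 3-uniform hypergraph containing no copy of $\mathcal{L}$, let $\mathcal{H}'$ be its 22-core, and let $Y$ be the set of vertices $y \in V(\mathcal{H}')$ with $\nu(Tr_{\mathcal{H}'}(y)) \ge 4$. For any $y \in Y$, if a triple $abc \in \mathcal{H}'$ intersects an edge $e$ of $Tr_{\mathcal{H}'}(y)$, then either $e \subset abc$ or $y \in abc$.
   Context: The loose path $\mathcal{L}$ is $\{abc, cde, efg\}$ on seven distinct vertices. The 22-core is obtained by iteratively deleting vertices of degree less than 22 (with their triples) until all remaining vertices have degree at least 22. $Tr_{\mathcal{H}'}(v) = \{ e \setminus \{v\} : e \in \mathcal{H}', v \in e\}$ is the trace graph of $v$; $\nu$ is the matching number. -}

module Defs where

open import Data.Nat using (ℕ; zero; suc; _<ᵇ_)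
open import Data.Bool using (Bool; true; false; _∧_)
open import Data.Fin using (Fin; zero; suc)
open import Data.Fin.Subset using (Subset; ⁅_⁆; _∪_; _∩_; _∈_; _⊆_; _-_; ⊤; Empty)
open import Data.Fin.Subset.Properties using (_⊆?_; _∈?_)
open import Data.Vec using ([]; _∷_)
open import Data.List using (List; []; _∷_; _++_; map; length; filterᵇ; allFin)
open import Data.Maybe using (Maybe; just; nothing)
open import Data.Product using (Σ; _×_)
open import Function.Definitions using (Injective)
open import Relation.Binary.PropositionalEquality using (_≡_; _≢_)
open import Relation.Nullary using (¬_; does)

-- A hypergraph on vertex set Fin n: characteristic function of its edge set
-- (edges are subsets of Fin n).
Hypergraph : ℕ → Set
Hypergraph n = Subset n → Bool

ThreeUniform : ∀ {n} → Hypergraph n → Set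
ThreeUniform {n} H = ∀ s → H s ≡ true → Data.Fin.Subset.∣ s ∣ ≡ 3

triple : ∀ {n} → Fin n → Fin n → Fin n → Subset n
triple a b c = ⁅ a ⁆ ∪ (⁅ b ⁆ ∪ ⁅ c ⁆)

-- H contains a copy of the loose path L = {abc, cde, efg} on seven distinct vertices
-- (vertices a,...,g = f 0, ..., f 6 for an injective f)
ContainsL : ∀ {n} → Hypergraph n → Set
ContainsL {n} H = Σ (Fin 7 → Fin n) λ f → Injective _≡_ _≡_ f ×
  (H (triple (f v0) (f v1) (f v2)) ≡ true ×
  (H (triple (f v2) (f v3) (f v4)) ≡ true ×
   H (triple (f v4) (f v5) (f v6)) ≡ true))
  where
  v0 v1 v2 v3 v4 v5 v6 : Fin 7
  v0 = zero
  v1 = suc zero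
  v2 = suc (suc zero)
  v3 = suc (suc (suc zero))
  v4 = suc (suc (suc (suc zero)))
  v5 = suc (suc (suc (suc (suc zero))))
  v6 = suc (suc (suc (suc (suc (suc zero)))))

allSubsets : (n : ℕ) → List (Subset n)
allSubsets zero = [] ∷ []
allSubsets (suc n) = map (true ∷_) (allSubsets n) ++ map (false ∷_) (allSubsets n)

induced : ∀ {n} → Hypergraph n → Subset n → Hypergraph n
induced H W s = H s ∧ does (s ⊆? W)

degree : ∀ {n} → Hypergraph n → Fin n → ℕ
degree {n} H v = length (filterᵇ (λ s → H s ∧ does (v ∈? s)) (allSubsets n))

lowVertex : ∀ {n} → ℕ → Hypergraph n → Subset n → Maybe (Fin n)
lowVertex {n} k H W = go (allFin n)
  where
  go : List (Fin n) → Maybe (Fin n)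
  go [] = nothing
  go (v ∷ vs) with does (v ∈? W) ∧ (degree (induced H W) v <ᵇ k)
  ... | true = just v
  ... | false = go vs

coreStep : ∀ {n} → ℕ → Hypergraph n → Subset n → Subset n
coreStep k H W with lowVertex k H W
... | just v = W - v
... | nothing = W

iterateN : ∀ {A : Set} → ℕ → (A → A) → A → A
iterateN zero f x = x
iterateN (suc m) f x = f (iterateN m f x)

-- vertex set of the k-core: iteratively delete vertices of degree < k;
-- n steps suffice since each effective step deletes a vertex.
coreVertices : ∀ {n} → ℕ → Hypergraph n → Subset n
coreVertices {n} k H = iterateN n (coreStep k H) ⊤

core : ∀ {n} → ℕ → Hypergraph n → Hypergraph n
core k H = induced H (coreVertices k H)

TrEdge : ∀ {n} → Hypergraph n → Fin n → Subset n → Set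
TrEdge {n} G v e = Σ (Subset n) λ s → G s ≡ true × v ∈ s × e ≡ s - v

MatchingNumberAtLeast : ∀ {n} → (Subset n → Set) → ℕ → Set
MatchingNumberAtLeast {n} E k = Σ (Fin k → Subset n) λ m →
  (∀ i → E (m i)) × (∀ i j → i ≢ j → Empty (m i ∩ m j))

-- Let G be a 3-uniform L-free hypergraph, y a vertex whose trace graph has
-- four disjoint edges {pᵢ, qᵢ}, and t an edge of G avoiding y.  A trace edge
-- {v, r} of y with v ∈ t, r ∉ t (a hook) yields the loose path
-- (t, v last), vry, ypⱼqⱼ for every pair j missing t and avoiding r.  Four
-- disjoint pairs cannot all meet the 3-set t, so some pair j misses t and
-- contains r; every other pair then lies inside t (meeting t once gives a new
-- hook, missing t forces it to contain r too), and two such pairs put four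
-- distinct vertices into t.  So there is no hook: trace edges meeting t lie
-- inside t.

module Submission where

open import Defs
open import Data.Nat using (ℕ; suc; pred; _<_)
open import Data.Nat.Properties using (n<1+n)
open import Data.Bool using (true; false)
open import Data.Fin using (Fin; zero; suc; _≟_)
open import Data.Fin.Properties using (pigeonhole; <⇒≢; any?; all?; ¬∀⟶∃¬)
open import Data.Fin.Subset
  using (Subset; _∈_; _∉_; _⊂_; _⊆_; _∩_; _∪_; _-_; ⁅_⁆; Nonempty; ∣_∣)
  renaming (⊥ to ∅)
open import Data.Fin.Subset.Properties
  using ( _∈?_; x∈⁅x⁆; x∈⁅y⁆⇒x≡y; x∈p∪q⁺; x∈p∪q⁻; x∈p∩q⁺; x∈p∩q⁻
        ; ∪-comm; ∪-assoc; ∪-identityˡ; ∪-identityʳ; drop-there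
        ; x∈p∧x≢y⇒x∈p-y; p─q⊆p)
open import Data.Vec using (Vec; []; _∷_; lookup; there)
open import Data.Vec.Relation.Unary.All as All using (All; []; _∷_)
open import Data.Vec.Relation.Unary.All.Properties using (lookup⁺; lookup⁻)
  renaming (tabulate⁺ to All-tabulate⁺)
open import Data.Vec.Relation.Unary.AllPairs using ([]; _∷_)
open import Data.Vec.Relation.Unary.AllPairs.Properties using (++⁺)
open import Data.Vec.Relation.Unary.Unique.Propositional using (Unique)
open import Data.Vec.Relation.Unary.Unique.Propositional.Properties
  using (lookup-injective) renaming (tabulate⁺ to Unique-tabulate⁺)
open import Data.Product using (Σ; ∃-syntax; _×_; _,_; proj₁; proj₂)
open import Data.Sum using (_⊎_; inj₁; inj₂; [_,_])
open import Data.Empty using (⊥; ⊥-elim)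
open import Function using (_∘_)
open import Relation.Binary.PropositionalEquality
  using (_≡_; _≢_; refl; sym; trans; cong; subst; ≢-sym; module ≡-Reasoning)
open import Relation.Nullary using (¬_; Dec; yes; no)
open import Relation.Nullary.Decidable using (_⊎-dec_)

private
  variable
    n k m : ℕ
    a b c v r y u w x z : Fin n
    s e : Subset n
    G H : Hypergraph n

Among : Fin n → Vec (Fin n) k → Set
Among x ws = ∃[ i ] x ≡ lookup ws i

among? : (x : Fin n) (ws : Vec (Fin n) k) → Dec (Among x ws)
among? x ws = any? (λ i → x ≟ lookup ws i)

distinct-among-fewer : {zs : Vec (Fin n) m} (ws : Vec (Fin n) k) → k < m →
  Unique zs → All (λ z → Among z ws) zs → ⊥
distinct-among-fewer {m = m} {k = k} {zs = zs} ws k<m unique among =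
  let i , j , i<j , same = pigeonhole k<m position
  in <⇒≢ i<j (lookup-injective unique i j (collide i j same))
  where
  position : Fin m → Fin k
  position i = proj₁ (lookup⁺ among i)

  collide : ∀ i j → position i ≡ position j → lookup zs i ≡ lookup zs j
  collide i j same = begin
    lookup zs i            ≡⟨ proj₂ (lookup⁺ among i) ⟩
    lookup ws (position i) ≡⟨ cong (lookup ws) same ⟩
    lookup ws (position j) ≡⟨ sym (proj₂ (lookup⁺ among j)) ⟩
    lookup zs j            ∎
    where open ≡-Reasoning

∈-triple⁻ : x ∈ triple a b c → Among x (a ∷ b ∷ c ∷ [])
∈-triple⁻ {a = a} {b = b} {c = c} x∈t with x∈p∪q⁻ ⁅ a ⁆ (⁅ b ⁆ ∪ ⁅ c ⁆) x∈t
... | inj₁ x∈a = zero , x∈⁅y⁆⇒x≡y a x∈a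
... | inj₂ x∈bc with x∈p∪q⁻ ⁅ b ⁆ ⁅ c ⁆ x∈bc
...   | inj₁ x∈b = suc zero , x∈⁅y⁆⇒x≡y b x∈b
...   | inj₂ x∈c = suc (suc zero) , x∈⁅y⁆⇒x≡y c x∈c

∈-triple⁺ : Among x (a ∷ b ∷ c ∷ []) → x ∈ triple a b c
∈-triple⁺ {a = a} (zero , refl) = x∈p∪q⁺ (inj₁ (x∈⁅x⁆ a))
∈-triple⁺ {b = b} (suc zero , refl) = x∈p∪q⁺ (inj₂ (x∈p∪q⁺ (inj₁ (x∈⁅x⁆ b))))
∈-triple⁺ {c = c} (suc (suc zero) , refl) = x∈p∪q⁺ (inj₂ (x∈p∪q⁺ (inj₂ (x∈⁅x⁆ c))))

triple-rotate : (a b c : Fin n) → triple a b c ≡ triple b c a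
triple-rotate a b c = trans (∪-comm ⁅ a ⁆ (⁅ b ⁆ ∪ ⁅ c ⁆)) (∪-assoc ⁅ b ⁆ ⁅ c ⁆ ⁅ a ⁆)

triple-swap : (a b c : Fin n) → triple a b c ≡ triple a c b
triple-swap a b c = cong (⁅ a ⁆ ∪_) (∪-comm ⁅ b ⁆ ⁅ c ⁆)

rotate-to : Unique (a ∷ b ∷ c ∷ []) → v ∈ triple a b c →
  Σ (Fin n) λ a′ → Σ (Fin n) λ b′ →
    triple a b c ≡ triple a′ b′ v × Unique (a′ ∷ b′ ∷ v ∷ [])
rotate-to {a = a} {b = b} {c = c} abc v∈t with abc | ∈-triple⁻ v∈t
... | (a≢b ∷ a≢c ∷ []) ∷ (b≢c ∷ []) ∷ [] ∷ [] | zero , refl =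
  b , c , triple-rotate a b c ,
  (b≢c ∷ ≢-sym a≢b ∷ []) ∷ (≢-sym a≢c ∷ []) ∷ [] ∷ []
... | (a≢b ∷ a≢c ∷ []) ∷ (b≢c ∷ []) ∷ [] ∷ [] | suc zero , refl =
  c , a , trans (triple-rotate a b c) (triple-rotate b c a) ,
  (≢-sym a≢c ∷ ≢-sym b≢c ∷ []) ∷ (a≢b ∷ []) ∷ [] ∷ []
... | _ | suc (suc zero) , refl = a , b , refl , abc

triple-escapes : Unique (a ∷ b ∷ c ∷ []) → (u w : Fin n) →
  ∃[ z ] z ∈ triple a b c × z ≢ u × z ≢ w
triple-escapes {a = a} {b = b} {c = c} abc u w = escape (all? covered?)
  where
  covered? : ∀ k → Dec (Among (lookup (a ∷ b ∷ c ∷ []) k) (u ∷ w ∷ []))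
  covered? k = among? (lookup (a ∷ b ∷ c ∷ []) k) (u ∷ w ∷ [])

  escape : Dec (∀ k → Among (lookup (a ∷ b ∷ c ∷ []) k) (u ∷ w ∷ [])) →
    ∃[ z ] z ∈ triple a b c × z ≢ u × z ≢ w
  escape (yes covered) = ⊥-elim (distinct-among-fewer (u ∷ w ∷ []) (n<1+n 2) abc (lookup⁻ covered))
  escape (no ¬covered) =
    let k , uncovered = ¬∀⟶∃¬ 3 _ covered? ¬covered
    in lookup (a ∷ b ∷ c ∷ []) k , ∈-triple⁺ (k , refl) ,
       (λ ≡u → uncovered (zero , ≡u)) , (λ ≡w → uncovered (suc zero , ≡w))

split : (s : Subset n) → ∣ s ∣ ≡ suc k →
  Σ (Fin n) λ x → Σ (Subset n) λ s′ → s ≡ ⁅ x ⁆ ∪ s′ × x ∉ s′ × ∣ s′ ∣ ≡ k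
split (true ∷ s) size = zero , false ∷ s , cong (true ∷_) (sym (∪-identityˡ s)) , (λ ()) , cong pred size
split (false ∷ s) size with x , s′ , s≡ , x∉s′ , size′ ← split s size =
  suc x , false ∷ s′ , cong (false ∷_) s≡ , x∉s′ ∘ drop-there , size′

size-zero : (s : Subset n) → ∣ s ∣ ≡ 0 → s ≡ ∅
size-zero [] _ = refl
size-zero (false ∷ s) size = cong (false ∷_) (size-zero s size)

∉⇒≢ : x ∉ s → z ∈ s → x ≢ z
∉⇒≢ x∉s z∈s refl = x∉s z∈s

size-three : (s : Subset n) → ∣ s ∣ ≡ 3 →
  Σ (Fin n) λ a → Σ (Fin n) λ b → Σ (Fin n) λ c →
    Unique (a ∷ b ∷ c ∷ []) × s ≡ triple a b c
size-three s size with split s size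
... | a , s₁ , refl , a∉s₁ , size₁ with split s₁ size₁
... | b , s₂ , refl , b∉s₂ , size₂ with split s₂ size₂
... | c , s₃ , refl , _ , size₃ with size-zero s₃ size₃
... | refl =
  a , b , c ,
  (∉⇒≢ a∉s₁ b∈s₁ ∷ ∉⇒≢ a∉s₁ c∈s₁ ∷ []) ∷ (∉⇒≢ b∉s₂ c∈s₂ ∷ []) ∷ [] ∷ [] ,
  cong (λ s′ → ⁅ a ⁆ ∪ (⁅ b ⁆ ∪ s′)) (∪-identityʳ ⁅ c ⁆)
  where
  c∈s₂ = x∈p∪q⁺ (inj₁ (x∈⁅x⁆ c))
  b∈s₁ = x∈p∪q⁺ (inj₁ (x∈⁅x⁆ b))
  c∈s₁ = x∈p∪q⁺ (inj₂ c∈s₂)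

edge-cong : {s t : Subset n} (H : Hypergraph n) → s ≡ t → H s ≡ true → H t ≡ true
edge-cong H = subst (λ s → H s ≡ true)

loose-path : (H : Hypergraph n) {x₁ x₂ x₃ x₄ x₅ x₆ x₇ : Fin n} →
  Unique (x₁ ∷ x₂ ∷ x₃ ∷ x₄ ∷ x₅ ∷ x₆ ∷ x₇ ∷ []) →
  H (triple x₁ x₂ x₃) ≡ true → H (triple x₃ x₄ x₅) ≡ true → H (triple x₅ x₆ x₇) ≡ true →
  ContainsL H
loose-path H {x₁} {x₂} {x₃} {x₄} {x₅} {x₆} {x₇} unique e₁ e₂ e₃ =
  lookup (x₁ ∷ x₂ ∷ x₃ ∷ x₄ ∷ x₅ ∷ x₆ ∷ x₇ ∷ []) ,
  (λ {i} {j} → lookup-injective unique i j) , e₁ , e₂ , e₃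

separated : {xs : Vec (Fin n) k} → All (_∉ triple a b c) xs →
  All (λ z → All (z ≢_) xs) (a ∷ b ∷ c ∷ [])
separated {a = a} {b = b} {c = c} {xs = xs} outside =
  avoids zero ∷ avoids (suc zero) ∷ avoids (suc (suc zero)) ∷ []
  where
  avoids : ∀ i → All (lookup (a ∷ b ∷ c ∷ []) i ≢_) xs
  avoids i = All.map (λ x∉t corner≡x → x∉t (∈-triple⁺ (i , sym corner≡x))) outside

hooked-path : (H : Hypergraph n) {p q : Fin n} →
  Unique (a ∷ b ∷ v ∷ []) → Unique (r ∷ y ∷ p ∷ q ∷ []) →
  All (_∉ triple a b v) (r ∷ y ∷ p ∷ q ∷ []) →
  H (triple a b v) ≡ true → H (triple y v r) ≡ true → H (triple y p q) ≡ true →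
  ContainsL H
hooked-path {v = v} {r = r} {y = y} H abv rypq outside e₁ e₂ e₃ =
  loose-path H (++⁺ abv rypq (separated outside)) e₁ (edge-cong H (triple-rotate y v r) e₂) e₃

record TracePair (H : Hypergraph n) (y p q : Fin n) : Set where
  constructor tracePair
  field
    p≢q : p ≢ q
    p≢y : p ≢ y
    q≢y : q ≢ y
    edge : H (triple y p q) ≡ true

flip-pair : ∀ {H : Hypergraph n} {y p q : Fin n} → TracePair H y p q → TracePair H y q p
flip-pair {H = H} {y = y} {p = p} {q = q} (tracePair p≢q p≢y q≢y edge) =
  tracePair (≢-sym p≢q) q≢y p≢y (edge-cong H (triple-swap y p q) edge)

record PairedTraceEdge (H : Hypergraph n) (y : Fin n) (e : Subset n) : Set where
  field
    p q : Fin n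
    pair : TracePair H y p q
    p∈e : p ∈ e
    q∈e : q ∈ e
    only : ∀ {x} → x ∈ e → x ≡ p ⊎ x ≡ q

∈-minus⇒≢ : x ∈ s - y → x ≢ y
∈-minus⇒≢ {s = s} {y = y} x∈s-y refl = self-removed s y x∈s-y
  where
  self-removed : ∀ {n} (s : Subset n) (y : Fin n) → y ∉ s - y
  self-removed (_ ∷ s) zero ()
  self-removed (_ ∷ s) (suc y) (there y∈) = self-removed s y y∈

-- Writing the edge s ∋ y of G as the triple pqy exhibits e = s - y as {p, q}.
paired-trace-edge : ThreeUniform G → TrEdge G y e → PairedTraceEdge G y e
paired-trace-edge {G = G} {y = y} uniform (s , s∈G , y∈s , refl)
  with size-three s (uniform s s∈G)
... | a , b , c , abc , refl with rotate-to abc y∈s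
... | p , q , t≡pqy , (p≢q ∷ p≢y ∷ []) ∷ (q≢y ∷ []) ∷ [] ∷ [] = record
  { p = p ; q = q
  ; pair = tracePair p≢q p≢y q≢y
      (edge-cong G (trans t≡pqy (trans (triple-rotate p q y) (triple-rotate q y p))) s∈G)
  ; p∈e = x∈p∧x≢y⇒x∈p-y (corner zero) p≢y
  ; q∈e = x∈p∧x≢y⇒x∈p-y (corner (suc zero)) q≢y
  ; only = only
  }
  where
  corner : ∀ k → lookup (p ∷ q ∷ y ∷ []) k ∈ triple a b c
  corner k = subst (_ ∈_) (sym t≡pqy) (∈-triple⁺ (k , refl))

  only : ∀ {x} → x ∈ triple a b c - y → x ≡ p ⊎ x ≡ q
  only x∈e with ∈-triple⁻ (subst (_ ∈_) t≡pqy (p─q⊆p _ _ x∈e))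
  ... | zero , x≡p = inj₁ x≡p
  ... | suc zero , x≡q = inj₂ x≡q
  ... | suc (suc zero) , x≡y = ⊥-elim (∈-minus⇒≢ x∈e x≡y)

Endpoint : (p q : Fin 4 → Fin n) → Fin 4 → Fin n → Set
Endpoint p q i x = x ≡ p i ⊎ x ≡ q i

record TraceMatching (H : Hypergraph n) (y : Fin n) : Set where
  field
    p q : Fin 4 → Fin n
    trace : ∀ i → TracePair H y (p i) (q i)
    disjoint : ∀ {i j x} → Endpoint p q i x → Endpoint p q j x → i ≡ j

trace-matching : ∀ {n} {G : Hypergraph n} {y : Fin n} →
  ThreeUniform G → MatchingNumberAtLeast (TrEdge G y) 4 → TraceMatching G y
trace-matching {n = n} {G = G} {y = y} uniform (m , m-trace , m-disjoint) = record
  { p = P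
  ; q = Q
  ; trace = λ i → PairedTraceEdge.pair (paired i)
  ; disjoint = disjoint
  }
  where
  paired : ∀ i → PairedTraceEdge G y (m i)
  paired i = paired-trace-edge uniform (m-trace i)

  P Q : Fin 4 → Fin n
  P = PairedTraceEdge.p ∘ paired
  Q = PairedTraceEdge.q ∘ paired

  endpoint∈ : ∀ {i x} → Endpoint P Q i x → x ∈ m i
  endpoint∈ {i} (inj₁ refl) = PairedTraceEdge.p∈e (paired i)
  endpoint∈ {i} (inj₂ refl) = PairedTraceEdge.q∈e (paired i)

  disjoint : ∀ {i j x} → Endpoint P Q i x → Endpoint P Q j x → i ≡ j
  disjoint {i} {j} {x} x∈i x∈j with i ≟ j
  ... | yes i≡j = i≡j
  ... | no i≢j = ⊥-elim (m-disjoint i j i≢j (x , x∈p∩q⁺ (endpoint∈ x∈i , endpoint∈ x∈j)))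

module Hooks {n} {H : Hypergraph n} (L-free : ¬ ContainsL H)
  {a b c y : Fin n} (abc : Unique (a ∷ b ∷ c ∷ [])) (t∈H : H (triple a b c) ≡ true)
  (y∉t : y ∉ triple a b c) (M : TraceMatching H y) where

  open TraceMatching M

  t : Subset n
  t = triple a b c

  apart : ∀ {i j} {x z : Fin n} → i ≢ j → Endpoint p q i x → Endpoint p q j z → x ≢ z
  apart i≢j x∈i z∈j refl = i≢j (disjoint x∈i z∈j)

  record Hook : Set where
    constructor hook
    field
      inner outer : Fin n
      inner∈t : inner ∈ t
      outer∉t : outer ∉ t
      pair : TracePair H y inner outer

  Meets Misses : Fin 4 → Set
  Meets i = p i ∈ t ⊎ q i ∈ t
  Misses i = p i ∉ t × q i ∉ t

  meets? : ∀ i → Dec (Meets i)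
  meets? i = (p i ∈? t) ⊎-dec (q i ∈? t)

  -- A hook {v, r} and a pair j that misses t and avoids r give the loose path
  -- (t listed with v last), vry, ypⱼqⱼ.  L-freeness rules this out.
  hook-path : ∀ {j} → (h : Hook) → Misses j → Hook.outer h ≢ p j → Hook.outer h ≢ q j → ⊥
  hook-path {j} (hook v r v∈t r∉t (tracePair _ _ r≢y vr∈H)) (pj∉t , qj∉t) r≢pj r≢qj
    with a′ , b′ , t≡ , a′b′v ← rotate-to abc v∈t =
    L-free (hooked-path H a′b′v rypq (subst (λ s → All (_∉ s) _) t≡ outside)
                          (edge-cong H t≡ t∈H) vr∈H (TracePair.edge (trace j)))
    where
    open TracePair (trace j) using (p≢q; p≢y; q≢y)
    rypq : Unique (r ∷ y ∷ p j ∷ q j ∷ [])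
    rypq = (r≢y ∷ r≢pj ∷ r≢qj ∷ []) ∷ (≢-sym p≢y ∷ ≢-sym q≢y ∷ []) ∷ (p≢q ∷ []) ∷ [] ∷ []
    outside : All (_∉ t) (r ∷ y ∷ p j ∷ q j ∷ [])
    outside = r∉t ∷ y∉t ∷ pj∉t ∷ qj∉t ∷ []

  outer-end-in : ∀ {j} (h : Hook) → Misses j → Endpoint p q j (Hook.outer h)
  outer-end-in {j} h misses with Hook.outer h ≟ p j | Hook.outer h ≟ q j
  ... | yes r≡pj | _ = inj₁ r≡pj
  ... | no _ | yes r≡qj = inj₂ r≡qj
  ... | no r≢pj | no r≢qj = ⊥-elim (hook-path h misses r≢pj r≢qj)

  inside : ∀ {i j} → Hook → Misses j → i ≢ j → p i ∈ t × q i ∈ t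
  inside {i} h misses i≢j with p i ∈? t | q i ∈? t
  ... | yes pi∈t | yes qi∈t = pi∈t , qi∈t
  ... | yes pi∈t | no qi∉t = ⊥-elim (hook-path (hook _ _ pi∈t qi∉t (trace i)) misses
          (apart i≢j (inj₂ refl) (inj₁ refl)) (apart i≢j (inj₂ refl) (inj₂ refl)))
  ... | no pi∉t | yes qi∈t = ⊥-elim (hook-path (hook _ _ qi∈t pi∉t (flip-pair (trace i))) misses
          (apart i≢j (inj₁ refl) (inj₁ refl)) (apart i≢j (inj₁ refl) (inj₂ refl)))
  ... | no pi∉t | no qi∉t =
    ⊥-elim (i≢j (disjoint (outer-end-in h (pi∉t , qi∉t)) (outer-end-in h misses)))

  -- Four disjoint pairs cannot all meet the 3-set t: choosing a meeting
  -- endpoint of each pair gives four distinct vertices of t.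
  not-all-meet : (∀ i → Meets i) → ⊥
  not-all-meet all-meet = distinct-among-fewer (a ∷ b ∷ c ∷ []) (n<1+n 3)
    (Unique-tabulate⁺ (λ {i} {j} same → disjoint (end∈ i) (subst (Endpoint p q j) (sym same) (end∈ j))))
    (All-tabulate⁺ (λ i → ∈-triple⁻ (proj₂ (proj₂ (meeting i)))))
    where
    meeting : ∀ i → Σ (Fin n) λ x → Endpoint p q i x × x ∈ t
    meeting i with all-meet i
    ... | inj₁ pi∈t = p i , inj₁ refl , pi∈t
    ... | inj₂ qi∈t = q i , inj₂ refl , qi∈t

    end∈ : ∀ i → Endpoint p q i (proj₁ (meeting i))
    end∈ i = proj₁ (proj₂ (meeting i))

  some-pair-misses : ∃[ j ] Misses j
  some-pair-misses with all? meets?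
  ... | yes all-meet = ⊥-elim (not-all-meet all-meet)
  ... | no ¬all-meet =
    let j , ¬meets = ¬∀⟶∃¬ 4 _ meets? ¬all-meet
    in j , ¬meets ∘ inj₁ , ¬meets ∘ inj₂

  -- Two distinct pairs inside t would be four distinct vertices of t.
  two-pairs-inside : ∀ {i j} → i ≢ j → p i ∈ t × q i ∈ t → p j ∈ t × q j ∈ t → ⊥
  two-pairs-inside {i} {j} i≢j (pi∈t , qi∈t) (pj∈t , qj∈t) =
    distinct-among-fewer (a ∷ b ∷ c ∷ []) (n<1+n 3)
      ( (TracePair.p≢q (trace i) ∷ apart i≢j (inj₁ refl) (inj₁ refl) ∷ apart i≢j (inj₁ refl) (inj₂ refl) ∷ [])
      ∷ (apart i≢j (inj₂ refl) (inj₁ refl) ∷ apart i≢j (inj₂ refl) (inj₂ refl) ∷ [])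
      ∷ (TracePair.p≢q (trace j) ∷ [])
      ∷ [] ∷ [])
      (∈-triple⁻ pi∈t ∷ ∈-triple⁻ qi∈t ∷ ∈-triple⁻ pj∈t ∷ ∈-triple⁻ qj∈t ∷ [])

  two-others : (j : Fin 4) → Σ (Fin 4) λ i₁ → Σ (Fin 4) λ i₂ → i₁ ≢ j × i₂ ≢ j × i₁ ≢ i₂
  two-others zero = suc zero , suc (suc zero) , (λ ()) , (λ ()) , (λ ())
  two-others (suc zero) = zero , suc (suc zero) , (λ ()) , (λ ()) , (λ ())
  two-others (suc (suc zero)) = zero , suc zero , (λ ()) , (λ ()) , (λ ())
  two-others (suc (suc (suc zero))) = zero , suc zero , (λ ()) , (λ ()) , (λ ())

  no-hook : Hook → ⊥
  no-hook h with some-pair-misses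
  ... | j , misses with two-others j
  ... | i₁ , i₂ , i₁≢j , i₂≢j , i₁≢i₂ =
    two-pairs-inside i₁≢i₂ (inside h misses i₁≢j) (inside h misses i₂≢j)

  inside-if-meets : ∀ {u w} → TracePair H y u w → u ∈ t ⊎ w ∈ t → u ∈ t × w ∈ t
  inside-if-meets {u} {w} uw meets with u ∈? t | w ∈? t
  ... | yes u∈t | yes w∈t = u∈t , w∈t
  ... | yes u∈t | no w∉t = ⊥-elim (no-hook (hook u w u∈t w∉t uw))
  ... | no u∉t | yes w∈t = ⊥-elim (no-hook (hook w u w∈t u∉t (flip-pair uw)))
  ... | no u∉t | no w∉t = ⊥-elim ([ u∉t , w∉t ] meets)

pair⊂triple : Unique (a ∷ b ∷ c ∷ []) → (∀ {x} → x ∈ e → x ≡ u ⊎ x ≡ w) →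
  u ∈ triple a b c → w ∈ triple a b c → e ⊂ triple a b c
pair⊂triple {a = a} {b = b} {c = c} {e = e} {u = u} {w = w} abc only u∈t w∈t =
  e⊆t , escape (triple-escapes abc u w)
  where
  e⊆t : e ⊆ triple a b c
  e⊆t x∈e with only x∈e
  ... | inj₁ refl = u∈t
  ... | inj₂ refl = w∈t
  escape : ∃[ z ] z ∈ triple a b c × z ≢ u × z ≢ w → ∃[ z ] z ∈ triple a b c × z ∉ e
  escape (z , z∈t , z≢u , z≢w) = z , z∈t , [ z≢u , z≢w ] ∘ only

trace-edge-inside-or-through : ThreeUniform G → ¬ ContainsL G →
  MatchingNumberAtLeast (TrEdge G y) 4 →
  ∀ (t : Subset n) → G t ≡ true → TrEdge G y e → Nonempty (t ∩ e) → e ⊂ t ⊎ y ∈ t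
trace-edge-inside-or-through {y = y} uniform L-free ν≥4 t t∈G y-edge (x , x∈t∩e)
  with y ∈? t
... | yes y∈t = inj₂ y∈t
... | no y∉t with size-three t (uniform t t∈G)
... | a , b , c , abc , refl = inj₁ (pair⊂triple abc only (proj₁ inside) (proj₂ inside))
  where
  open PairedTraceEdge (paired-trace-edge uniform y-edge)
  open Hooks L-free abc t∈G y∉t (trace-matching uniform ν≥4) using (inside-if-meets)
  meets : p ∈ triple a b c ⊎ q ∈ triple a b c
  meets with x∈p∩q⁻ (triple a b c) _ x∈t∩e
  ... | x∈t , x∈e with only x∈e
  ...   | inj₁ refl = inj₁ x∈t
  ...   | inj₂ refl = inj₂ x∈t
  inside : p ∈ triple a b c × q ∈ triple a b c
  inside = inside-if-meets pair meets

_⊑_ : Hypergraph n → Hypergraph n → Set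
G ⊑ H = ∀ s → G s ≡ true → H s ≡ true

induced-⊑ : (H : Hypergraph n) (W : Subset n) → induced H W ⊑ H
induced-⊑ H W s with H s
... | true = λ _ → refl
... | false = λ ()

⊑-three-uniform : G ⊑ H → ThreeUniform H → ThreeUniform G
⊑-three-uniform G⊑H uniform s = uniform s ∘ G⊑H s

⊑-containsL : G ⊑ H → ContainsL G → ContainsL H
⊑-containsL G⊑H (f , injective , e₁ , e₂ , e₃) = f , injective , G⊑H _ e₁ , G⊑H _ e₂ , G⊑H _ e₃

-- The 22-core is a subhypergraph of H, hence 3-uniform and L-free.
mainTheorem8 : ∀ {n : ℕ} (H : Hypergraph n) → ThreeUniform H → ¬ ContainsL H →
    ∀ (y : Fin n) → y ∈ coreVertices 22 H → MatchingNumberAtLeast (TrEdge (core 22 H) y) 4 →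
    ∀ (t e : Subset n) → core 22 H t ≡ true → TrEdge (core 22 H) y e → Nonempty (t ∩ e) →
    e ⊂ t ⊎ y ∈ t
mainTheorem8 H uniform L-free y _ ν≥4 t e =
  trace-edge-inside-or-through (⊑-three-uniform core⊑H uniform) (L-free ∘ ⊑-containsL core⊑H) ν≥4 t
  where
  core⊑H : core 22 H ⊑ H
  core⊑H = induced-⊑ H (coreVertices 22 H)
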